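{- (Intuitionistic logic.) Let $a,b\in\mathbb Q$, let $A$ be a type and $(q_\alpha)_{\alpha:A},(r_\alpha)_{\alpha:A}$ families of rational numbers satisfying CovL. Then there exist $n\in\mathbb N$ and $F:[n]\to A$ such that $[a,b]_{\mathrm{cut}}\subseteq\mathop{\boxplus}_{i:[n]}(q_{F(i)},r_{F(i)})_{\mathrm{cut}}$.
   Context: All in intuitionistic logic, with an impredicative type of propositions. A lowercut is $L\subseteq\mathbb Q$ that is a lower set ($a<b\wedge b\in L\to a\in L$) and upwards-open ($a\in L\to\exists b,(a<b\wedge b\in L)$); an uppercut is $U\subseteq\mathbb Q$ that is an upper set ($a<b\wedge a\in U\to b\in U$) and downwards-open ($b\in U\to\exists a,(a<b\wedge a\in U)$). A cut is a pair $x=(L,U)$ of a lowercut and an uppercut with $\forall a,b,(a\in L\wedge b\in U\to a<b)$; $\mathfrak I$ is the type of cuts. For a lowercut $L$, $\overline L:=\{q\mid\forall r,(r<q\to r\in L)\}$; for an uppercut $U$, $\overline U:=\{q\mid\forall r,(q<r\to r\in U)\}$. For $x=(L,U)$ and $q\in\mathbb Q$: $q<x:\Leftrightarrow q\in L$, $q\le x:\Leftrightarrow q\in\overline L$, $x<q:\Leftrightarrow q\in U$, $x\le q:\Leftrightarrow q\in\overline U$. A complemented subset of $X$ is a pair $V=(V^+,V^-)$ of subsets with $x\in V^+\to x\notin V^-$. Inclusion: $V\subseteq W$ iff $V^+\subseteq W^+$ and $W^-\subseteq V^-$. Multiplicative union: $V\boxplus W:=(\{x\mid(x\in V^-\to x\in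 W^+)\wedge(x\in W^-\to x\in V^+)\},\ V^-\cap W^-)$; the finite version $\mathop{\boxplus}_{i:[n]}$ is defined inductively (empty one $(\emptyset,X)$). For $a,b\in\mathbb Q$: $[a,b]_{\mathrm{cut}}:=(\{x:\mathfrak I\mid a\le x\wedge x\le b\},\{x\mid(a\le x\to b<x)\wedge(x\le b\to x<a)\})$ and $(a,b)_{\mathrm{cut}}:=(\{x\mid a<x\wedge x<b\},\{x\mid(a<x\to b\le x)\wedge(x<b\to x\le a)\})$. CovL (for $a,b,q,r$): for every lowercut $L$, if $q_\alpha\in L\to r_\alpha\in\overline L$ holds for all $\alpha:A$, then $a\in\overline L\to b\in L$. -}

module Defs where

open import Level using (Level; _⊔_; 0ℓ) renaming (suc to lsuc)
open import Data.Nat using (ℕ; zero; suc)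
open import Data.Fin using (Fin; zero; suc)
open import Data.Rational using (ℚ; _<_)
open import Data.Rational.Properties using (<-irrefl; <-trans)
open import Data.Product using (Σ; ∃; _×_; _,_; proj₁; proj₂)
open import Data.Empty using (⊥)
open import Relation.Nullary using (¬_)
open import Relation.Binary.PropositionalEquality using (refl)

-- Subsets (predicates) of ℚ at universe level ℓ.
-- The paper works with an impredicative Prop; we use Set ℓ and
-- make levels explicit.
Pred : ∀ {a} → Set a → (ℓ : Level) → Set (a ⊔ lsuc ℓ)
Pred X ℓ = X → Set ℓ

record IsLowercut {ℓ} (L : Pred ℚ ℓ) : Set ℓ where
  field
    lower  : ∀ {a b} → a < b → L b → L a
    upOpen : ∀ {a} → L a → ∃ λ b → a < b × L b

record IsUppercut {ℓ} (U : Pred ℚ ℓ) : Set ℓ where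
  field
    upper    : ∀ {a b} → a < b → U a → U b
    downOpen : ∀ {b} → U b → ∃ λ a → a < b × U a

closeL : ∀ {ℓ} → Pred ℚ ℓ → Pred ℚ ℓ
closeL L q = ∀ r → r < q → L r

closeU : ∀ {ℓ} → Pred ℚ ℓ → Pred ℚ ℓ
closeU U q = ∀ r → q < r → U r

record Cut (ℓ : Level) : Set (lsuc ℓ) where
  field
    L : Pred ℚ ℓ
    U : Pred ℚ ℓ
    isLower : IsLowercut L
    isUpper : IsUppercut U
    separated : ∀ {a b} → L a → U b → a < b
open Cut public

_<ᶜ_ : ∀ {ℓ} → ℚ → Cut ℓ → Set ℓ
q <ᶜ x = L x q

_≤ᶜ_ : ∀ {ℓ} → ℚ → Cut ℓ → Set ℓ
q ≤ᶜ x = closeL (L x) q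

_ᶜ<_ : ∀ {ℓ} → Cut ℓ → ℚ → Set ℓ
x ᶜ< q = U x q

_ᶜ≤_ : ∀ {ℓ} → Cut ℓ → ℚ → Set ℓ
x ᶜ≤ q = closeU (U x) q

record CSubset {a} (X : Set a) (ℓ : Level) : Set (a ⊔ lsuc ℓ) where
  field
    pos : Pred X ℓ
    neg : Pred X ℓ
    disjoint : ∀ x → pos x → ¬ neg x
open CSubset public

_⊆ᶜ_ : ∀ {a ℓ} {X : Set a} → CSubset X ℓ → CSubset X ℓ → Set (a ⊔ ℓ)
V ⊆ᶜ W = (∀ x → pos V x → pos W x) × (∀ x → neg W x → neg V x)

_⊞_ : ∀ {a ℓ} {X : Set a} → CSubset X ℓ → CSubset X ℓ → CSubset X ℓ
V ⊞ W = record
  { pos = λ x → (neg V x → pos W x) × (neg W x → pos V x)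
  ; neg = λ x → neg V x × neg W x
  ; disjoint = λ x p n → disjoint W x (proj₁ p (proj₁ n)) (proj₂ n)
  }

emptyᶜ : ∀ {a ℓ} {X : Set a} → CSubset X ℓ
emptyᶜ {ℓ = ℓ} = record
  { pos = λ _ → Level.Lift ℓ ⊥
  ; neg = λ _ → Level.Lift ℓ (Data.Unit.⊤)
  ; disjoint = λ { x (Level.lift ()) _ }
  }
  where import Data.Unit

bigUnion : ∀ {a ℓ} {X : Set a} (n : ℕ) → (Fin n → CSubset X ℓ) → CSubset X ℓ
bigUnion zero    V = emptyᶜ
bigUnion (suc n) V = V zero ⊞ bigUnion n (λ i → V (suc i))

private
  noLU : ∀ {ℓ} (x : Cut ℓ) {q} → L x q → closeU (U x) q → ⊥
  noLU x lq cu with IsLowercut.upOpen (isLower x) lq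
  ... | c , q<c , lc = <-irrefl refl (separated x lc (cu c q<c))

  noUL : ∀ {ℓ} (x : Cut ℓ) {q} → U x q → closeL (L x) q → ⊥
  noUL x uq cl with IsUppercut.downOpen (isUpper x) uq
  ... | c , c<q , uc = <-irrefl refl (separated x (cl c c<q) uc)

closedᶜ : ∀ {ℓ} → ℚ → ℚ → CSubset (Cut ℓ) ℓ
closedᶜ a b = record
  { pos = λ x → (a ≤ᶜ x) × (x ᶜ≤ b)
  ; neg = λ x → (a ≤ᶜ x → b <ᶜ x) × (x ᶜ≤ b → x ᶜ< a)
  ; disjoint = λ x p n → noLU x (proj₁ n (proj₁ p)) (proj₂ p)
  }

openᶜ : ∀ {ℓ} → ℚ → ℚ → CSubset (Cut ℓ) ℓ
openᶜ a b = record
  { pos = λ x → (a <ᶜ x) × (x ᶜ< b)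
  ; neg = λ x → (a <ᶜ x → b ≤ᶜ x) × (x ᶜ< b → x ᶜ≤ a)
  ; disjoint = λ x p n → noUL x (proj₂ p) (proj₁ n (proj₁ p))
  }

CovL : ∀ {i} (ℓ : Level) (A : Set i) (a b : ℚ) (q r : A → ℚ) → Set (i ⊔ lsuc ℓ)
CovL ℓ A a b q r =
  (L : Pred ℚ ℓ) → IsLowercut L →
  (∀ α → L (q α) → closeL L (r α)) → closeL L a → L b

{-# OPTIONS --safe #-}
module Submission where

-- Apply CovL to the lowercut of those c lying strictly below some c' for which [a,c'] is covered
-- by finitely many of the intervals (q_α, r_α).  It contains every c < a (the empty union covers
-- the empty interval [a,c']), and if [a,c'] is covered with q_α < c', then adjoining (q_α, r_α)
-- covers [a,d] for each d < r_α.  CovL then puts b in this lowercut.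

open import Defs
open import Level using (Level; _⊔_) renaming (suc to lsuc)
open import Data.Nat using (ℕ; zero; suc)
open import Data.Fin using (Fin; zero; suc)
open import Data.Rational using (ℚ; _<_)
open import Data.Rational.Properties using (<-dense; <-trans; <-irrefl)
open import Data.Product using (Σ; ∃; _×_; _,_; proj₁; proj₂)
open import Relation.Binary.PropositionalEquality using (refl)

⊆ᶜ-trans : ∀ {a ℓ} {X : Set a} {U V W : CSubset X ℓ} → U ⊆ᶜ V → V ⊆ᶜ W → U ⊆ᶜ W
⊆ᶜ-trans (pos⊆₁ , neg⊇₁) (pos⊆₂ , neg⊇₂) = (λ x u → pos⊆₂ x (pos⊆₁ x u)) , (λ x w → neg⊇₁ x (neg⊇₂ x w))

Below : ∀ {ℓ} → Pred ℚ ℓ → Pred ℚ ℓ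
Below P c = ∃ λ c′ → c < c′ × P c′

Below-isLowercut : ∀ {ℓ} {P : Pred ℚ ℓ} → IsLowercut (Below P)
Below-isLowercut = record
  { lower  = λ c<d (e , d<e , Pe) → e , <-trans c<d d<e , Pe
  ; upOpen = λ (e , c<e , Pe) → let m , c<m , m<e = <-dense c<e in m , c<m , e , m<e , Pe
  }

module _ {ℓ : Level} (x : Cut ℓ) {c d : ℚ} where

  <-<ᶜ-trans : c < d → d <ᶜ x → c <ᶜ x
  <-<ᶜ-trans = IsLowercut.lower (isLower x)

  ᶜ≤-<-trans : x ᶜ≤ c → c < d → x ᶜ< d
  ᶜ≤-<-trans x≤c c<d = x≤c d c<d

  ᶜ≤-<-weaken : x ᶜ≤ c → c < d → x ᶜ≤ d
  ᶜ≤-<-weaken x≤c c<d s d<s = x≤c s (<-trans c<d d<s)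

module _ {ℓ : Level} {a : ℚ} where

  closedᶜ-monoʳ : ∀ {c d} → c < d → closedᶜ {ℓ} a c ⊆ᶜ closedᶜ a d
  closedᶜ-monoʳ c<d =
    (λ x (a≤x , x≤c) → a≤x , ᶜ≤-<-weaken x x≤c c<d) ,
    (λ x (a≤x⇒d<x , x≤d⇒x<a) →
      (λ a≤x → <-<ᶜ-trans x c<d (a≤x⇒d<x a≤x)) ,
      (λ x≤c → x≤d⇒x<a (ᶜ≤-<-weaken x x≤c c<d)))

  closedᶜ-empty : ∀ {c} → c < a → closedᶜ {ℓ} a c ⊆ᶜ emptyᶜ
  closedᶜ-empty {c} c<a with m , c<m , m<a ← <-dense c<a =
    (λ x (a≤x , x≤c) → separated-absurd x a≤x x≤c) , (λ x _ → outside x)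
    where
    separated-absurd : ∀ {p} {P : Set p} (x : Cut ℓ) → a ≤ᶜ x → x ᶜ≤ c → P
    separated-absurd x a≤x x≤c with () ← <-irrefl refl (separated x (a≤x m m<a) (x≤c m c<m))
    outside : (x : Cut ℓ) → neg (closedᶜ a c) x
    outside x = (λ a≤x → <-<ᶜ-trans x c<m (a≤x m m<a)) ,
                (λ x≤c → ᶜ≤-<-trans x (ᶜ≤-<-weaken x x≤c c<m) m<a)

  closedᶜ-extend : ∀ {c d s t} (U : CSubset (Cut ℓ) ℓ) → s < c → d < t →
                   closedᶜ a c ⊆ᶜ U → closedᶜ a d ⊆ᶜ (openᶜ s t ⊞ U)
  closedᶜ-extend {c} {d} {s} {t} U s<c d<t (inU , outU) = pos⊆ , neg⊇
    where
    pos⊆ : ∀ x → pos (closedᶜ a d) x → pos (openᶜ s t ⊞ U) x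
    pos⊆ x (a≤x , x≤d) = notOpen⇒inU , notU⇒inOpen
      where
      x<t = ᶜ≤-<-trans x x≤d d<t
      notOpen⇒inU = λ (_ , x<t⇒x≤s) → inU x (a≤x , ᶜ≤-<-weaken x (x<t⇒x≤s x<t) s<c)
      notU⇒inOpen = λ notU → <-<ᶜ-trans x s<c (proj₁ (outU x notU) a≤x) , x<t
    neg⊇ : ∀ x → neg (openᶜ s t ⊞ U) x → neg (closedᶜ a d) x
    neg⊇ x ((s<x⇒t≤x , x<t⇒x≤s) , notU) = a≤x⇒d<x , x≤d⇒x<a
      where
      a≤x⇒d<x = λ a≤x → s<x⇒t≤x (<-<ᶜ-trans x s<c (proj₁ (outU x notU) a≤x)) d d<t
      x≤d⇒x<a = λ x≤d → proj₂ (outU x notU)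
                          (ᶜ≤-<-weaken x (x<t⇒x≤s (ᶜ≤-<-trans x x≤d d<t)) s<c)

module FiniteCovers {i} {A : Set i} (q r : A → ℚ) (ℓ : Level) (a : ℚ) where

  Covers : ℚ → Set (i ⊔ lsuc ℓ)
  Covers c = Σ ℕ (λ n → Σ (Fin n → A) (λ F →
    closedᶜ {ℓ} a c ⊆ᶜ bigUnion n (λ k → openᶜ (q (F k)) (r (F k)))))

  Covers-lower : ∀ {c d} → c < d → Covers d → Covers c
  Covers-lower {c} {d} c<d (n , F , cover) =
    n , F , ⊆ᶜ-trans {U = closedᶜ a c} {V = closedᶜ a d} {W = bigUnion n _} (closedᶜ-monoʳ c<d) cover

  Covers-empty : ∀ {c} → c < a → Covers c
  Covers-empty c<a = zero , (λ ()) , closedᶜ-empty c<a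

  Covers-extend : ∀ α {c d} → q α < c → d < r α → Covers c → Covers d
  Covers-extend α q<c d<r (n , F , cover) =
    suc n , (λ { zero → α ; (suc k) → F k }) , closedᶜ-extend (bigUnion n _) q<c d<r cover

  Below-Covers-start : closeL (Below Covers) a
  Below-Covers-start c c<a = let m , c<m , m<a = <-dense c<a in m , c<m , Covers-empty m<a

  Below-Covers-step : ∀ α → Below Covers (q α) → closeL (Below Covers) (r α)
  Below-Covers-step α (c , q<c , covered) d d<r =
    let m , d<m , m<r = <-dense d<r in m , d<m , Covers-extend α q<c m<r covered

theorem37 : {i : Level} (A : Set i) (a b : ℚ) (q r : A → ℚ) →
    (∀ ℓ → CovL ℓ A a b q r) →
    (ℓ : Level) →
    Σ ℕ (λ n → Σ (Fin n → A) (λ F →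
      closedᶜ {ℓ} a b ⊆ᶜ bigUnion n (λ k → openᶜ (q (F k)) (r (F k)))))
theorem37 {i} A a b q r covL ℓ =
  let c , b<c , covered = covL (i ⊔ lsuc ℓ) (Below Covers) Below-isLowercut
                               Below-Covers-step Below-Covers-start
  in Covers-lower b<c covered
  where open FiniteCovers q r ℓ a
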